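{- Let $\mathbf{d}=(d_1,\dots,d_n)$ be a degree sequence such that $\sum_{i=1}^n d_i$ is even, $\sum_{i=1}^n d_i\le 4(n-1)$, $n>4$, $d_1\le n-1$ and $d_n\ge 2$. If $d_4\ge 3$, then $\mathbf{d}$ is graphical.
   Context: A degree sequence is a non-increasing sequence $d_1\ge\dots\ge d_n$ of non-negative integers; it is graphical if there is a simple graph on vertices $v_1,\dots,v_n$ with $\deg(v_i)=d_i$ for all $i$. -}

module Defs where

open import Data.Nat using (ℕ; zero; suc; _+_; _≥_)
open import Data.Fin using (Fin; zero; suc; _≤_)
open import Data.Bool using (Bool; true; false)
open import Relation.Binary.PropositionalEquality using (_≡_)

sumFin : (n : ℕ) → (Fin n → ℕ) → ℕ
sumFin zero    f = 0
sumFin (suc n) f = f zero + sumFin n (λ i → f (suc i))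

countTrue : (n : ℕ) → (Fin n → Bool) → ℕ
countTrue zero    b = 0
countTrue (suc n) b with b zero
... | true  = suc (countTrue n (λ i → b (suc i)))
... | false = countTrue n (λ i → b (suc i))

-- A simple graph on vertex set Fin n (vertices v_1..v_n are zero..n-1),
-- given by a symmetric, loopless adjacency function.
record SimpleGraph (n : ℕ) : Set where
  field
    adj      : Fin n → Fin n → Bool
    symmetric : ∀ i j → adj i j ≡ adj j i
    loopless  : ∀ i → adj i i ≡ false

degree : {n : ℕ} → SimpleGraph n → Fin n → ℕ
degree {n} G i = countTrue n (SimpleGraph.adj G i)

NonIncreasing : {n : ℕ} → (Fin n → ℕ) → Set
NonIncreasing {n} d = ∀ (i j : Fin n) → i ≤ j → d i ≥ d j

Graphical : {n : ℕ} → (Fin n → ℕ) → Set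
Graphical {n} d = Σ' (SimpleGraph n) (λ G → ∀ i → degree G i ≡ d i)
  where
  open import Data.Product using () renaming (Σ to Σ')

open import Data.Nat using (_<_; _∸_; s≤s)
n∸1<n : {n : ℕ} → 4 < n → n ∸ 1 < n
n∸1<n {suc n} _ = s≤s (Data.Nat.Properties.≤-refl)
  where import Data.Nat.Properties

{-# OPTIONS --safe #-}
module Submission where

-- The invariant implies graphicality by induction on n, running Havel–Hakimi backwards: as
-- the sum is below 4n, some vertex has degree k ∈ {2, 3}; it is removed and joined to k
-- vertices of degree ≥ 3 including every vertex of full degree n-1.  Degree counting shows
-- that there are at most k full vertices, so such neighbours exist, and the residual sequence
-- on n-1 vertices is again admissible, provided a vertex of degree 3 is used whenever three
-- other vertices of degree ≥ 3 are available.  This only fails for (2, …, 2, D) with D even: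
-- for D = n-1 it is realised by triangles sharing a vertex, for smaller D by subdividing edges.

open import Data.Bool using (Bool; true; false; T; _∧_; _∨_; not; if_then_else_)
open import Data.Bool.Properties using (T-≡; ∨-zeroʳ; ∨-identityʳ; ∧-identityʳ; ∧-zeroʳ; ∧-comm; ∨-comm)
open import Data.Empty using (⊥-elim)
open import Data.Fin using (Fin; zero; suc; fromℕ; fromℕ<; toℕ; punchOut)
open import Data.Fin.Permutation using (Permutation′; _⟨$⟩ʳ_; flip; inverseʳ; transpose)
open import Data.Fin.Properties using (punchInᵢ≢i; any?; toℕ<n; toℕ-fromℕ<)
import Data.Fin.Properties as Fin
open import Data.Nat
  using (ℕ; zero; suc; _+_; _*_; _∸_; _≤_; _<_; s≤s; s≤s⁻¹; z≤n; _≤ᵇ_; _≡ᵇ_; _≟_; _≤?_)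
open import Data.Nat.Divisibility using (_∣_; divides; ∣m+n∣m⇒∣n; m∣m*n; n∣m*n)
open import Data.Nat.Properties
open import Algebra.Properties.Semiring.Sum +-*-semiring
  using (sum; sum-remove; sum-permute; sum-cong-≗; ∑-distrib-+)
open import Data.Nat.Tactic.RingSolver using (solve-∀)
open import Data.Product using (∃; _,_; _×_; proj₁; proj₂)
open import Data.Sum using (_⊎_; inj₁; inj₂)
import Data.Sum as Sum
open import Data.Vec.Functional using (removeAt; _∷_)
open import Data.Vec.Functional.Properties using (removeAt-punchOut)
open import Function using (_∘_)
open import Function.Bundles using (Equivalence)
open import Relation.Binary.PropositionalEquality
open import Relation.Nullary using (yes; no; does; ¬_; contradiction)
open import Relation.Nullary.Decidable using (dec-true; dec-false; T?)

open import Defs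

-- Counting

bit : Bool → ℕ
bit false = 0
bit true  = 1

1≤bit : ∀ {x} → T x → 1 ≤ bit x
1≤bit {true} _ = ≤-refl

bit≤ : ∀ {b x} → (T b → 1 ≤ x) → bit b ≤ x
bit≤ {false} _   = z≤n
bit≤ {true}  pos = pos _

infix 4 _⊆_

_⊆_ : ∀ {n} → (Fin n → Bool) → (Fin n → Bool) → Set
A ⊆ B = ∀ v → T (A v) → T (B v)

⁅_⁆ : ∀ {n} → Fin n → Fin n → Bool
⁅ u ⁆ v = does (v Fin.≟ u)

⁅⁆-self : ∀ {n} (u : Fin n) → ⁅ u ⁆ u ≡ true
⁅⁆-self u = dec-true (u Fin.≟ u) refl

⁅⁆-other : ∀ {n} {u v : Fin n} → v ≢ u → ⁅ u ⁆ v ≡ false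
⁅⁆-other {u = u} {v} v≢u = dec-false (v Fin.≟ u) v≢u

sumFin≡sum : ∀ n (f : Fin n → ℕ) → sumFin n f ≡ sum f
sumFin≡sum zero    f = refl
sumFin≡sum (suc n) f = cong (f zero +_) (sumFin≡sum n (f ∘ suc))

sum-mono-≤ : ∀ {n} {f g : Fin n → ℕ} → (∀ v → f v ≤ g v) → sum f ≤ sum g
sum-mono-≤ {zero}  f≤g = z≤n
sum-mono-≤ {suc n} f≤g = +-mono-≤ (f≤g zero) (sum-mono-≤ (f≤g ∘ suc))

sum-const : ∀ n c → sum {n} (λ _ → c) ≡ n * c
sum-const zero    c = refl
sum-const (suc n) c = cong (c +_) (sum-const n c)

countTrue-suc : ∀ {n} (b : Fin (suc n) → Bool) → countTrue (suc n) b ≡ bit (b zero) + countTrue n (b ∘ suc)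
countTrue-suc b with b zero
... | false = refl
... | true  = refl

countTrue≡sum : ∀ {n} (b : Fin n → Bool) → countTrue n b ≡ sum (bit ∘ b)
countTrue≡sum {zero}  b = refl
countTrue≡sum {suc n} b = trans (countTrue-suc b) (cong (bit (b zero) +_) (countTrue≡sum (b ∘ suc)))

countTrue-cong : ∀ {n} {b c : Fin n → Bool} → b ≗ c → countTrue n b ≡ countTrue n c
countTrue-cong {n} {b} {c} b≗c = begin
  countTrue n b  ≡⟨ countTrue≡sum b ⟩
  sum (bit ∘ b)  ≡⟨ sum-cong-≗ (cong bit ∘ b≗c) ⟩
  sum (bit ∘ c)  ≡⟨ countTrue≡sum c ⟨
  countTrue n c  ∎
  where open ≡-Reasoning

countTrue-mono : ∀ {n} {A B : Fin n → Bool} → A ⊆ B → countTrue n A ≤ countTrue n B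
countTrue-mono {n} {A} {B} A⊆B = begin
  countTrue n A  ≡⟨ countTrue≡sum A ⟩
  sum (bit ∘ A)  ≤⟨ sum-mono-≤ bit-mono ⟩
  sum (bit ∘ B)  ≡⟨ countTrue≡sum B ⟨
  countTrue n B  ∎
  where
  open ≤-Reasoning
  bit-mono : ∀ v → bit (A v) ≤ bit (B v)
  bit-mono v with A v | B v | A⊆B v
  ... | false | _     | _    = z≤n
  ... | true  | true  | _    = ≤-refl
  ... | true  | false | A⇒B = ⊥-elim (A⇒B _)

countTrue-permute : ∀ {n} (π : Permutation′ n) (b : Fin n → Bool) → countTrue n (b ∘ (π ⟨$⟩ʳ_)) ≡ countTrue n b
countTrue-permute {n} π b = begin
  countTrue n (b ∘ (π ⟨$⟩ʳ_)) ≡⟨ countTrue≡sum (b ∘ (π ⟨$⟩ʳ_)) ⟩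
  sum (bit ∘ b ∘ (π ⟨$⟩ʳ_))   ≡⟨ sum-permute (bit ∘ b) π ⟨
  sum (bit ∘ b)               ≡⟨ countTrue≡sum b ⟨
  countTrue n b               ∎
  where open ≡-Reasoning

countTrue-removeAt : ∀ {n} (b : Fin (suc n) → Bool) i → countTrue (suc n) b ≡ bit (b i) + countTrue n (removeAt b i)
countTrue-removeAt {n} b i = begin
  countTrue (suc n) b                    ≡⟨ countTrue≡sum b ⟩
  sum (bit ∘ b)                          ≡⟨ sum-remove (bit ∘ b) ⟩
  bit (b i) + sum (bit ∘ removeAt b i)   ≡⟨ cong (bit (b i) +_) (countTrue≡sum (removeAt b i)) ⟨
  bit (b i) + countTrue n (removeAt b i) ∎
  where open ≡-Reasoning

countTrue-update : ∀ {n} (b c : Fin (suc n) → Bool) w → (∀ v → v ≢ w → b v ≡ c v) →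
                   countTrue (suc n) b + bit (c w) ≡ countTrue (suc n) c + bit (b w)
countTrue-update {n} b c w b≡c = begin
  countTrue (suc n) b + bit (c w)                    ≡⟨ cong (_+ bit (c w)) (countTrue-removeAt b w) ⟩
  bit (b w) + countTrue n (removeAt b w) + bit (c w) ≡⟨ cong (λ k → bit (b w) + k + bit (c w)) removeAt≡ ⟩
  bit (b w) + countTrue n (removeAt c w) + bit (c w) ≡⟨ swap (bit (b w)) (countTrue n (removeAt c w)) (bit (c w)) ⟩
  bit (c w) + countTrue n (removeAt c w) + bit (b w) ≡⟨ cong (_+ bit (b w)) (countTrue-removeAt c w) ⟨
  countTrue (suc n) c + bit (b w)                    ∎
  where
  open ≡-Reasoning
  removeAt≡ : countTrue n (removeAt b w) ≡ countTrue n (removeAt c w)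
  removeAt≡ = countTrue-cong (λ l → b≡c _ (punchInᵢ≢i w l))
  swap : ∀ x y z → x + y + z ≡ z + y + x
  swap = solve-∀

countTrue-drop : ∀ {n} (b : Fin (suc n) → Bool) w → b w ≡ true →
                 countTrue (suc n) (λ y → b y ∧ not (⁅ w ⁆ y)) + 1 ≡ countTrue (suc n) b
countTrue-drop {n} b w bw = begin
  countTrue (suc n) b∖w + 1               ≡⟨ cong (λ x → countTrue (suc n) b∖w + bit x) bw ⟨
  countTrue (suc n) b∖w + bit (b w)       ≡⟨ countTrue-update b∖w b w off-w ⟩
  countTrue (suc n) b + bit (b∖w w)       ≡⟨ cong (λ e → countTrue (suc n) b + bit (b w ∧ not e)) (⁅⁆-self w) ⟩
  countTrue (suc n) b + bit (b w ∧ false) ≡⟨ cong (λ x → countTrue (suc n) b + bit x) (∧-zeroʳ (b w)) ⟩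
  countTrue (suc n) b + 0                 ≡⟨ +-identityʳ _ ⟩
  countTrue (suc n) b                     ∎
  where
  open ≡-Reasoning
  b∖w : Fin (suc n) → Bool
  b∖w y = b y ∧ not (⁅ w ⁆ y)
  off-w : ∀ y → y ≢ w → b∖w y ≡ b y
  off-w y y≢w = trans (cong (λ e → b y ∧ not e) (⁅⁆-other y≢w)) (∧-identityʳ (b y))

countTrue-none : ∀ n → countTrue n (λ _ → false) ≡ 0
countTrue-none zero    = refl
countTrue-none (suc n) = countTrue-none n

countTrue-all : ∀ {n} (b : Fin n → Bool) → (∀ v → T (b v)) → countTrue n b ≡ n
countTrue-all {zero}  b all = refl
countTrue-all {suc n} b all with b zero | all zero
... | true | _ = cong suc (countTrue-all (b ∘ suc) (all ∘ suc))

countTrue-⁅⁆ : ∀ {n} (u : Fin n) → countTrue n ⁅ u ⁆ ≡ 1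
countTrue-⁅⁆ {suc n} zero    = cong suc (countTrue-none n)
countTrue-⁅⁆ {suc n} (suc u) = countTrue-⁅⁆ u

countTrue-pair : ∀ {n} {u w : Fin (suc n)} → u ≢ w → countTrue (suc n) (λ v → ⁅ u ⁆ v ∨ ⁅ w ⁆ v) ≡ 2
countTrue-pair {n} {u} {w} u≢w = begin
  countTrue (suc n) pair                 ≡⟨ +-identityʳ _ ⟨
  countTrue (suc n) pair + 0             ≡⟨ cong (λ b → countTrue (suc n) pair + bit b) (⁅⁆-other (u≢w ∘ sym)) ⟨
  countTrue (suc n) pair + bit (⁅ u ⁆ w) ≡⟨ countTrue-update pair ⁅ u ⁆ w off-w ⟩
  countTrue (suc n) ⁅ u ⁆ + bit (pair w) ≡⟨ cong₂ (λ k b → k + bit b) (countTrue-⁅⁆ u) pair-w ⟩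
  2                                      ∎
  where
  open ≡-Reasoning
  pair : Fin (suc n) → Bool
  pair v = ⁅ u ⁆ v ∨ ⁅ w ⁆ v
  off-w : ∀ v → v ≢ w → pair v ≡ ⁅ u ⁆ v
  off-w v v≢w = trans (cong (⁅ u ⁆ v ∨_) (⁅⁆-other v≢w)) (∨-identityʳ _)
  pair-w : pair w ≡ true
  pair-w = trans (cong (⁅ u ⁆ w ∨_) (⁅⁆-self w)) (∨-zeroʳ _)

countTrue-witness : ∀ {n} (b : Fin n → Bool) → 1 ≤ countTrue n b → ∃ λ v → T (b v)
countTrue-witness {suc n} b pos with b zero in b₀
... | true  = zero , subst T (sym b₀) _
... | false with countTrue-witness (b ∘ suc) pos
...   | v , bv = suc v , bv

countTrue-≥1 : ∀ {n} (b : Fin (suc n) → Bool) v → T (b v) → 1 ≤ countTrue (suc n) b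
countTrue-≥1 {n} b v bv = begin
  1                                      ≤⟨ 1≤bit bv ⟩
  bit (b v)                              ≤⟨ m≤m+n _ _ ⟩
  bit (b v) + countTrue n (removeAt b v) ≡⟨ countTrue-removeAt b v ⟨
  countTrue (suc n) b                    ∎
  where open ≤-Reasoning

countTrue-≥2 : ∀ {n} (b : Fin n → Bool) {u v} → u ≢ v → T (b u) → T (b v) → 2 ≤ countTrue n b
countTrue-≥2 {suc zero}    b {zero} {zero} u≢v = ⊥-elim (u≢v refl)
countTrue-≥2 {suc (suc n)} b {u} {v} u≢v bu bv = begin
  2                                            ≤⟨ +-mono-≤ (1≤bit bu) (countTrue-≥1 (removeAt b u) _ bv′) ⟩
  bit (b u) + countTrue (suc n) (removeAt b u) ≡⟨ countTrue-removeAt b u ⟨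
  countTrue (suc (suc n)) b                    ∎
  where
  open ≤-Reasoning
  bv′ : T (removeAt b u (punchOut u≢v))
  bv′ = subst T (sym (removeAt-punchOut b u≢v)) bv

prefix≤countTrue : ∀ {n} k (b : Fin n → Bool) → k ≤ n → (∀ v → toℕ v < k → T (b v)) → k ≤ countTrue n b
prefix≤countTrue zero    b _ _ = z≤n
prefix≤countTrue {suc n} (suc k) b (s≤s k≤n) prefix with b zero | prefix zero (s≤s z≤n)
... | true | _ = s≤s (prefix≤countTrue k (b ∘ suc) k≤n (λ v v<k → prefix (suc v) (s≤s v<k)))

weighted-count≤sum : ∀ {n} (P : Fin n → Bool) (f : Fin n → ℕ) c k →
                     (∀ v → c + k * bit (P v) ≤ f v) → n * c + k * countTrue n P ≤ sum f
weighted-count≤sum {zero}  P f c k _ = ≤-reflexive (*-zeroʳ k)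
weighted-count≤sum {suc n} P f c k bound = begin
  suc n * c + k * countTrue (suc n) P                          ≡⟨ cong (λ x → suc n * c + k * x) (countTrue-suc P) ⟩
  suc n * c + k * (bit (P zero) + countTrue n (P ∘ suc))       ≡⟨ regroup n c k (bit (P zero)) (countTrue n (P ∘ suc)) ⟩
  (c + k * bit (P zero)) + (n * c + k * countTrue n (P ∘ suc)) ≤⟨ +-mono-≤ (bound zero) tail≤ ⟩
  f zero + sum (f ∘ suc)                                       ∎
  where
  open ≤-Reasoning
  tail≤ : n * c + k * countTrue n (P ∘ suc) ≤ sum (f ∘ suc)
  tail≤ = weighted-count≤sum (P ∘ suc) (f ∘ suc) c k (bound ∘ suc)
  regroup : ∀ n c k b r → suc n * c + k * (b + r) ≡ (c + k * b) + (n * c + k * r)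
  regroup = solve-∀

intermediate-subset-suc : ∀ {n} (A B : Fin (suc n) → Bool) (y : Bool) {k} →
                          (T (A zero) → T y) → (T y → T (B zero)) →
                          (∃ λ Y → A ∘ suc ⊆ Y × Y ⊆ B ∘ suc × countTrue n Y ≡ k) →
                          ∃ λ Y → A ⊆ Y × Y ⊆ B × countTrue (suc n) Y ≡ bit y + k
intermediate-subset-suc A B y A₀⇒y y⇒B₀ (Y , A⊆Y , Y⊆B , |Y|) =
  y ∷ Y , (λ { zero → A₀⇒y ; (suc v) → A⊆Y v }) , (λ { zero → y⇒B₀ ; (suc v) → Y⊆B v }) ,
  trans (countTrue-suc (y ∷ Y)) (cong (bit y +_) |Y|)

intermediate-subset : ∀ {n} (A B : Fin n → Bool) {k} → A ⊆ B → countTrue n A ≤ k → k ≤ countTrue n B →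
                      ∃ λ Y → A ⊆ Y × Y ⊆ B × countTrue n Y ≡ k
intermediate-subset {zero} A B A⊆B A≤k k≤B = A , (λ _ a → a) , A⊆B , sym (n≤0⇒n≡0 k≤B)
intermediate-subset {suc n} A B {k} A⊆B A≤k k≤B with A zero in a₀ | B zero in b₀ | A⊆B zero
... | true  | false | A₀⇒B₀ = ⊥-elim (A₀⇒B₀ _)
intermediate-subset {suc n} A B {suc k} A⊆B (s≤s A≤k) k≤B | true | true | _ =
  intermediate-subset-suc A B true (λ _ → _) (λ _ → subst T (sym b₀) _)
    (intermediate-subset (A ∘ suc) (B ∘ suc) (A⊆B ∘ suc) A≤k (s≤s⁻¹ k≤B))
... | false | false | _ =
  intermediate-subset-suc A B false (subst T a₀) (λ ())
    (intermediate-subset (A ∘ suc) (B ∘ suc) (A⊆B ∘ suc) A≤k k≤B)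
... | false | true  | _ with k ≤? countTrue n (B ∘ suc)
...   | yes k≤B′ =
  intermediate-subset-suc A B false (subst T a₀) (λ ())
    (intermediate-subset (A ∘ suc) (B ∘ suc) (A⊆B ∘ suc) A≤k k≤B′)
...   | no  k≰B′ =
  subst (λ k → ∃ λ Y → A ⊆ Y × Y ⊆ B × countTrue (suc n) Y ≡ k) (≤-antisym (≰⇒> k≰B′) k≤B)
    (intermediate-subset-suc A B true (λ _ → _) (λ _ → subst T (sym b₀) _)
      (intermediate-subset (A ∘ suc) (B ∘ suc) (A⊆B ∘ suc) (countTrue-mono (A⊆B ∘ suc)) ≤-refl))

-- Graph constructions

open SimpleGraph

Graphical-cong : ∀ {n} {d e : Fin n → ℕ} → d ≗ e → Graphical d → Graphical e
Graphical-cong d≗e (G , deg) = G , λ v → trans (deg v) (d≗e v)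

permuteGraph : ∀ {n} → Permutation′ n → SimpleGraph n → SimpleGraph n
permuteGraph π G = record
  { adj       = λ x y → adj G (π ⟨$⟩ʳ x) (π ⟨$⟩ʳ y)
  ; symmetric = λ x y → symmetric G (π ⟨$⟩ʳ x) (π ⟨$⟩ʳ y)
  ; loopless  = λ x → loopless G (π ⟨$⟩ʳ x)
  }

Graphical-permute : ∀ {n} {d : Fin n → ℕ} (π : Permutation′ n) → Graphical d → Graphical (d ∘ (π ⟨$⟩ʳ_))
Graphical-permute π (G , deg) =
  permuteGraph π G , λ v → trans (countTrue-permute π (adj G (π ⟨$⟩ʳ v))) (deg (π ⟨$⟩ʳ v))

Graphical-unpermute : ∀ {n} {d : Fin n → ℕ} (π : Permutation′ n) → Graphical (d ∘ (π ⟨$⟩ʳ_)) → Graphical d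
Graphical-unpermute {d = d} π = Graphical-cong (λ v → cong d (inverseʳ π)) ∘ Graphical-permute (flip π)

addVertex : ∀ {m} → SimpleGraph m → (Fin m → Bool) → SimpleGraph (suc m)
addVertex {m} G N = record { adj = adj⁺ ; symmetric = symmetric⁺ ; loopless = loopless⁺ }
  where
  adj⁺ : Fin (suc m) → Fin (suc m) → Bool
  adj⁺ zero    zero    = false
  adj⁺ zero    (suc y) = N y
  adj⁺ (suc x) zero    = N x
  adj⁺ (suc x) (suc y) = adj G x y
  symmetric⁺ : ∀ x y → adj⁺ x y ≡ adj⁺ y x
  symmetric⁺ zero    zero    = refl
  symmetric⁺ zero    (suc y) = refl
  symmetric⁺ (suc x) zero    = refl
  symmetric⁺ (suc x) (suc y) = symmetric G x y
  loopless⁺ : ∀ x → adj⁺ x x ≡ false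
  loopless⁺ zero    = refl
  loopless⁺ (suc x) = loopless G x

residual : ∀ {m} → (Fin (suc m) → ℕ) → (Fin m → Bool) → Fin m → ℕ
residual d Y l = d (suc l) ∸ bit (Y l)

layoff-graphical : ∀ {m} (d : Fin (suc m) → ℕ) (Y : Fin m → Bool) → countTrue m Y ≡ d zero →
                   (∀ l → T (Y l) → 1 ≤ d (suc l)) → Graphical (residual d Y) → Graphical d
layoff-graphical d Y |Y| pos (G , deg) = addVertex G Y , λ
  { zero    → |Y|
  ; (suc l) → begin
      degree (addVertex G Y) (suc l) ≡⟨ countTrue-suc (adj (addVertex G Y) (suc l)) ⟩
      bit (Y l) + degree G l         ≡⟨ cong (bit (Y l) +_) (deg l) ⟩
      bit (Y l) + residual d Y l     ≡⟨ m+[n∸m]≡n (bit≤ (pos l)) ⟩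
      d (suc l)                      ∎
  }
  where open ≡-Reasoning

sum-residual : ∀ {m} (d : Fin (suc m) → ℕ) (Y : Fin m → Bool) → countTrue m Y ≡ d zero →
               (∀ l → T (Y l) → 1 ≤ d (suc l)) → sum (residual d Y) + 2 * d zero ≡ sum d
sum-residual d Y |Y| pos = begin
  sum (residual d Y) + 2 * d zero                 ≡⟨ regroup (sum (residual d Y)) (d zero) ⟩
  d zero + (sum (residual d Y) + d zero)          ≡⟨ cong (λ k → d zero + (sum (residual d Y) + k)) |Y|≡ ⟩
  d zero + (sum (residual d Y) + sum (bit ∘ Y))   ≡⟨ cong (d zero +_) (∑-distrib-+ (residual d Y) (bit ∘ Y)) ⟨
  d zero + sum (λ l → residual d Y l + bit (Y l)) ≡⟨ cong (d zero +_) (sum-cong-≗ (m∸n+n≡m ∘ bit≤ ∘ pos)) ⟩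
  sum d                                           ∎
  where
  open ≡-Reasoning
  |Y|≡ : d zero ≡ sum (bit ∘ Y)
  |Y|≡ = trans (sym |Y|) (countTrue≡sum Y)
  regroup : ∀ s x → s + 2 * x ≡ x + (s + x)
  regroup = solve-∀

edge : ∀ {n} → Fin n → Fin n → Fin n → Fin n → Bool
edge u w x y = (⁅ u ⁆ x ∧ ⁅ w ⁆ y) ∨ (⁅ w ⁆ x ∧ ⁅ u ⁆ y)

edge-sym : ∀ {n} (u w x y : Fin n) → edge u w x y ≡ edge u w y x
edge-sym u w x y = trans (cong₂ _∨_ (∧-comm (⁅ u ⁆ x) (⁅ w ⁆ y)) (∧-comm (⁅ w ⁆ x) (⁅ u ⁆ y)))
                         (∨-comm (⁅ w ⁆ y ∧ ⁅ u ⁆ x) (⁅ u ⁆ y ∧ ⁅ w ⁆ x))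

removeEdge : ∀ {n} → SimpleGraph n → Fin n → Fin n → SimpleGraph n
removeEdge G u w = record
  { adj       = λ x y → adj G x y ∧ not (edge u w x y)
  ; symmetric = λ x y → cong₂ (λ a e → a ∧ not e) (symmetric G x y) (edge-sym u w x y)
  ; loopless  = λ x → cong (_∧ not (edge u w x x)) (loopless G x)
  }

degree-removeEdge : ∀ {n} (G : SimpleGraph (suc n)) {u w} → u ≢ w → adj G u w ≡ true → ∀ x →
                    degree (removeEdge G u w) x + bit (⁅ u ⁆ x ∨ ⁅ w ⁆ x) ≡ degree G x
degree-removeEdge {n} G {u} {w} u≢w uw x with x Fin.≟ u | x Fin.≟ w
... | yes refl | yes refl = ⊥-elim (u≢w refl)
... | yes refl | no _     =
  trans (cong (_+ 1) (countTrue-cong (λ y → cong (λ e → adj G u y ∧ not e) (∨-identityʳ (⁅ w ⁆ y)))))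
        (countTrue-drop (adj G u) w uw)
... | no _     | yes refl = countTrue-drop (adj G w) u (trans (symmetric G w u) uw)
... | no _     | no _     = trans (+-identityʳ _) (countTrue-cong (λ y → ∧-identityʳ (adj G x y)))

subdivision-graphical : ∀ {m} (d : Fin (suc m) → ℕ) → d zero ≡ 2 → (u : Fin m) → 1 ≤ d (suc u) →
                        Graphical (d ∘ suc) → Graphical d
subdivision-graphical {suc m} d d₀≡2 u pos (G , deg)
  with countTrue-witness (adj G u) (subst (1 ≤_) (sym (deg u)) pos)
... | w , uw = layoff-graphical d Y (trans (countTrue-pair u≢w) (sym d₀≡2)) Y-pos (removeEdge G u w , deg⁻)
  where
  Y : Fin (suc m) → Bool
  Y v = ⁅ u ⁆ v ∨ ⁅ w ⁆ v
  u≢w : u ≢ w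
  u≢w refl = subst T (loopless G u) uw
  uw′ : adj G u w ≡ true
  uw′ = Equivalence.to T-≡ uw
  Y-pos : ∀ v → T (Y v) → 1 ≤ d (suc v)
  Y-pos v Yv with v Fin.≟ u | v Fin.≟ w
  ... | yes refl | _        = pos
  ... | no _     | yes refl = subst (1 ≤_) (deg w) (countTrue-≥1 (adj G w) u (subst T (symmetric G u w) uw))
  deg⁻ : ∀ v → degree (removeEdge G u w) v ≡ residual d Y v
  deg⁻ v = begin
    degree (removeEdge G u w) v                         ≡⟨ m+n∸n≡m _ (bit (Y v)) ⟨
    degree (removeEdge G u w) v + bit (Y v) ∸ bit (Y v) ≡⟨ cong (_∸ bit (Y v)) (degree-removeEdge G u≢w uw′ v) ⟩
    degree G v ∸ bit (Y v)                              ≡⟨ cong (_∸ bit (Y v)) (deg v) ⟩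
    residual d Y v                                      ∎
    where open ≡-Reasoning

-- Sequences with a single degree different from 2

spike : ∀ {m} → ℕ → Fin (suc m) → ℕ
spike {m} D v = if ⁅ fromℕ m ⁆ v then D else 2

-- t triangles sharing the last vertex; each step splits one triangle off by two layoffs.
windmill-graphical : ∀ t → Graphical (spike {t * 2} (t * 2))
windmill-graphical zero = empty , λ { zero → refl }
  where
  empty : SimpleGraph 1
  empty = record { adj = λ _ _ → false ; symmetric = λ _ _ → refl ; loopless = λ _ → refl }
windmill-graphical (suc t) =
  layoff-graphical d Y₁ (cong suc (countTrue-⁅⁆ last)) Y₁-pos
    (layoff-graphical (residual d Y₁) ⁅ last ⁆ (countTrue-⁅⁆ last) Y₂-pos
      (Graphical-cong twice-residual (windmill-graphical t)))
  where
  last : Fin (1 + t * 2)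
  last = fromℕ (t * 2)
  d : Fin (3 + t * 2) → ℕ
  d = spike (2 + t * 2)
  Y₁ : Fin (2 + t * 2) → Bool
  Y₁ = true ∷ ⁅ last ⁆
  Y₁-pos : ∀ l → T (Y₁ l) → 1 ≤ d (suc l)
  Y₁-pos zero    _ = s≤s z≤n
  Y₁-pos (suc l) _ with ⁅ last ⁆ l
  ... | true  = s≤s z≤n
  ... | false = s≤s z≤n
  Y₂-pos : ∀ l → T (⁅ last ⁆ l) → 1 ≤ residual d Y₁ (suc l)
  Y₂-pos l _ with ⁅ last ⁆ l
  ... | true  = s≤s z≤n
  ... | false = s≤s z≤n
  twice-residual : spike (t * 2) ≗ residual (residual d Y₁) ⁅ last ⁆
  twice-residual l with ⁅ last ⁆ l
  ... | true  = refl
  ... | false = refl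

spike-graphical : ∀ m {D} → 2 ∣ D → 2 ≤ D → D ≤ m → Graphical (spike {m} D)
spike-graphical m {D} 2∣D 2≤D D≤m with D ≟ m
spike-graphical m 2∣D 2≤D D≤m | yes refl with 2∣D
... | divides t refl = windmill-graphical t
spike-graphical zero    2∣D ()  z≤n | no _
spike-graphical (suc m) {D} 2∣D 2≤D D≤m | no D≢m =
  subdivision-graphical (spike D) refl zero spike-pos (spike-graphical m 2∣D 2≤D (s≤s⁻¹ (≤∧≢⇒< D≤m D≢m)))
  where
  spike-pos : 1 ≤ spike {m} D zero
  spike-pos with ⁅ fromℕ m ⁆ zero
  ... | true  = ≤-trans (s≤s z≤n) 2≤D
  ... | false = s≤s z≤n

almost-2-regular-graphical : ∀ {m} (d : Fin (suc m) → ℕ) a → (∀ v → v ≢ a → d v ≡ 2) →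
                             2 ∣ d a → 2 ≤ d a → d a ≤ m → Graphical d
almost-2-regular-graphical {m} d a others 2∣dₐ 2≤dₐ dₐ≤m =
  Graphical-unpermute τ (Graphical-cong shape (spike-graphical m 2∣dₐ 2≤dₐ dₐ≤m))
  where
  τ : Permutation′ (suc m)
  τ = transpose (fromℕ m) a
  shape : spike (d a) ≗ d ∘ (τ ⟨$⟩ʳ_)
  shape v with v Fin.≟ fromℕ m
  ... | yes _ = refl
  ... | no v≢last with v Fin.≟ a
  ...   | yes refl = sym (others (fromℕ m) (v≢last ∘ sym))
  ...   | no v≢a   = sym (others v v≢a)

-- The admissible sequences

large : ℕ → Bool
large x = 3 ≤ᵇ x

Slack : ∀ {n} → (Fin n → ℕ) → Set
Slack {n} d = sum d + 6 ≤ 4 * n ⊎ 4 ≤ countTrue n (large ∘ d)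

record Admissible {n} (d : Fin n → ℕ) : Set where
  field
    lower : ∀ v → 2 ≤ d v
    upper : ∀ v → d v < n
    even  : 2 ∣ sum d
    bound : sum d + 4 ≤ 4 * n
    slack : Slack d

AdmissibleGraphical : ℕ → Set
AdmissibleGraphical n = ∀ (d : Fin n → ℕ) → Admissible d → Graphical d

Admissible-permute : ∀ {n} {d : Fin n → ℕ} (π : Permutation′ n) → Admissible d → Admissible (d ∘ (π ⟨$⟩ʳ_))
Admissible-permute {n} {d} π A = record
  { lower = lower ∘ (π ⟨$⟩ʳ_)
  ; upper = upper ∘ (π ⟨$⟩ʳ_)
  ; even  = subst (2 ∣_) Σ≡ even
  ; bound = subst (λ s → s + 4 ≤ 4 * n) Σ≡ bound
  ; slack = Sum.map (subst (λ s → s + 6 ≤ 4 * n) Σ≡) (subst (4 ≤_) (sym (countTrue-permute π (large ∘ d)))) slack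
  }
  where
  open Admissible A
  Σ≡ : sum d ≡ sum (d ∘ (π ⟨$⟩ʳ_))
  Σ≡ = sum-permute d π

full : ∀ {m} → (Fin (suc m) → ℕ) → Fin m → Bool
full {m} d l = d (suc l) ≡ᵇ m

-- A full vertex is adjacent to every other vertex, in particular to vertex zero; putting
-- all of them into Y is what keeps the residual degrees below m.
record LayoffSet {m} (d : Fin (suc m) → ℕ) (Y : Fin m → Bool) : Set where
  field
    size   : countTrue m Y ≡ d zero
    ⊆large : Y ⊆ large ∘ d ∘ suc
    full⊆  : full d ⊆ Y

  pos : ∀ l → T (Y l) → 1 ≤ d (suc l)
  pos l Yl = ≤-trans (s≤s z≤n) (≤ᵇ⇒≤ 3 _ (⊆large l Yl))

  sum≡ : sum (residual d Y) + 2 * d zero ≡ sum d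
  sum≡ = sum-residual d Y size pos

x+4≤4[1+m]⇒x≤4m : ∀ {x} m → x + 4 ≤ 4 * suc m → x ≤ 4 * m
x+4≤4[1+m]⇒x≤4m {x} m h = +-cancelʳ-≤ 4 x (4 * m) (subst (x + 4 ≤_) (trans (*-suc 4 m) (+-comm 4 (4 * m))) h)

residual-admissible : ∀ {m} {d : Fin (suc m) → ℕ} {Y} → Admissible d → LayoffSet d Y → 2 ≤ d zero →
                      Slack (residual d Y) → Admissible (residual d Y)
residual-admissible {m} {d} {Y} A L 2≤d₀ slack′ =
  record { lower = lower′ ; upper = upper′ ; even = even′ ; bound = bound′ ; slack = slack′ }
  where
  open Admissible A
  open LayoffSet L
  lower′ : ∀ l → 2 ≤ residual d Y l
  lower′ l with Y l in Yl
  ... | true  = ∸-monoˡ-≤ 1 (≤ᵇ⇒≤ 3 (d (suc l)) (⊆large l (subst T (sym Yl) _)))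
  ... | false = lower (suc l)
  upper′ : ∀ l → residual d Y l < m
  upper′ l with Y l in Yl
  ... | true  = ≤-trans (≤-reflexive (m+[n∸m]≡n (pos l (subst T (sym Yl) _)))) (s≤s⁻¹ (upper (suc l)))
  ... | false = ≤∧≢⇒< (s≤s⁻¹ (upper (suc l))) (λ isFull → subst T Yl (full⊆ l (≡⇒≡ᵇ _ _ isFull)))
  even′ : 2 ∣ sum (residual d Y)
  even′ = ∣m+n∣m⇒∣n (subst (2 ∣_) (trans (sym sum≡) (+-comm _ (2 * d zero))) even) (m∣m*n (d zero))
  bound′ : sum (residual d Y) + 4 ≤ 4 * m
  bound′ = x+4≤4[1+m]⇒x≤4m m (begin
    sum (residual d Y) + 4 + 4          ≤⟨ +-monoˡ-≤ 4 (+-monoʳ-≤ (sum (residual d Y)) (*-monoʳ-≤ 2 2≤d₀)) ⟩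
    sum (residual d Y) + 2 * d zero + 4 ≡⟨ cong (_+ 4) sum≡ ⟩
    sum d + 4                           ≤⟨ bound ⟩
    4 * suc m                           ∎)
    where open ≤-Reasoning

full⊆large : ∀ {t} (d : Fin (4 + t) → ℕ) → full d ⊆ large ∘ d ∘ suc
full⊆large {t} d l isFull =
  ≤⇒≤ᵇ (≤-trans (m≤m+n 3 t) (≤-reflexive (sym (≡ᵇ⇒≡ (d (suc l)) (3 + t) isFull))))

full-weight : ∀ {t} {d : Fin (4 + t) → ℕ} → Admissible d →
              (3 + t) * 2 + (1 + t) * countTrue (3 + t) (full d) ≤ sum (d ∘ suc)
full-weight {t} {d} A = weighted-count≤sum (full d) (d ∘ suc) 2 (1 + t) weight
  where
  weight : ∀ l → 2 + (1 + t) * bit (full d l) ≤ d (suc l)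
  weight l with full d l in isFull
  ... | true  = ≤-reflexive (trans (cong (2 +_) (*-identityʳ (1 + t)))
                                   (sym (≡ᵇ⇒≡ (d (suc l)) (3 + t) (subst T (sym isFull) _))))
  ... | false = ≤-trans (≤-reflexive (cong (2 +_) (*-zeroʳ (1 + t)))) (Admissible.lower A (suc l))

few-full : ∀ {t} {d : Fin (4 + t) → ℕ} k → Admissible d →
           ¬ (d zero + ((3 + t) * 2 + (1 + t) * suc k) ≤ sum d) → countTrue (3 + t) (full d) ≤ k
few-full {t} {d} k A small with countTrue (3 + t) (full d) ≤? k
... | yes f≤k = f≤k
... | no  f≰k = contradiction
  (+-monoʳ-≤ (d zero) (≤-trans (+-monoʳ-≤ ((3 + t) * 2) (*-monoʳ-≤ (1 + t) (≰⇒> f≰k))) (full-weight A))) small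

layoff-step : ∀ {t} {d : Fin (4 + t) → ℕ} → Admissible d → 2 ≤ d zero →
              countTrue (3 + t) (full d) ≤ d zero → d zero ≤ countTrue (3 + t) (large ∘ d ∘ suc) →
              (∀ {Y} → LayoffSet d Y → Slack (residual d Y)) → AdmissibleGraphical (3 + t) → Graphical d
layoff-step {t} {d} A 2≤d₀ full≤d₀ d₀≤large slack ih
  with intermediate-subset (full d) (large ∘ d ∘ suc) (full⊆large d) full≤d₀ d₀≤large
... | Y , full⊆Y , Y⊆large , |Y| =
  layoff-graphical d Y |Y| (LayoffSet.pos L) (ih (residual d Y) (residual-admissible A L 2≤d₀ (slack L)))
  where
  L : LayoffSet d Y
  L = record { size = |Y| ; ⊆large = Y⊆large ; full⊆ = full⊆Y }

layoff-three : ∀ {t} {d : Fin (4 + t) → ℕ} → Admissible d → d zero ≡ 3 → 4 ≤ countTrue (4 + t) (large ∘ d) →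
               AdmissibleGraphical (3 + t) → Graphical d
layoff-three {t} {d} A d₀≡3 four =
  layoff-step A (≤-trans (n≤1+n 2) d₀≥3) (≤-trans (few-full 3 A too-many) d₀≥3)
              (≤-trans (≤-reflexive d₀≡3) three-large) roomy
  where
  open Admissible A
  open ≤-Reasoning
  d₀≥3 : 3 ≤ d zero
  d₀≥3 = ≤-reflexive (sym d₀≡3)
  three-large : 3 ≤ countTrue (3 + t) (large ∘ d ∘ suc)
  three-large = s≤s⁻¹ (subst (4 ≤_) tail≡ four)
    where
    tail≡ : countTrue (4 + t) (large ∘ d) ≡ 1 + countTrue (3 + t) (large ∘ d ∘ suc)
    tail≡ = trans (countTrue-suc (large ∘ d))
                  (cong (λ x → bit (large x) + countTrue (3 + t) (large ∘ d ∘ suc)) d₀≡3)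
  too-many : ¬ (d zero + ((3 + t) * 2 + (1 + t) * 4) ≤ sum d)
  too-many big = m+1+n≰m (4 * (4 + t)) (begin
    4 * (4 + t) + suc (2 * t)                ≡⟨ excess t ⟩
    3 + ((3 + t) * 2 + (1 + t) * 4) + 4      ≡⟨ cong (λ x → x + ((3 + t) * 2 + (1 + t) * 4) + 4) d₀≡3 ⟨
    d zero + ((3 + t) * 2 + (1 + t) * 4) + 4 ≤⟨ +-monoˡ-≤ 4 big ⟩
    sum d + 4                                ≤⟨ bound ⟩
    4 * (4 + t)                              ∎)
    where
    excess : ∀ t → 4 * (4 + t) + suc (2 * t) ≡ 3 + ((3 + t) * 2 + (1 + t) * 4) + 4
    excess = solve-∀
  roomy : ∀ {Y} → LayoffSet d Y → Slack (residual d Y)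
  roomy {Y} L = inj₁ (x+4≤4[1+m]⇒x≤4m (3 + t) (begin
    sum (residual d Y) + 6 + 4          ≡⟨ cong (λ x → sum (residual d Y) + 2 * x + 4) d₀≡3 ⟨
    sum (residual d Y) + 2 * d zero + 4 ≡⟨ cong (_+ 4) (LayoffSet.sum≡ L) ⟩
    sum d + 4                           ≤⟨ bound ⟩
    4 * (4 + t)                         ∎))

large-tail : ∀ {m} (d : Fin (suc m) → ℕ) → d zero ≡ 2 →
             countTrue (suc m) (large ∘ d) ≡ countTrue m (large ∘ d ∘ suc)
large-tail {m} d d₀≡2 =
  trans (countTrue-suc (large ∘ d)) (cong (λ x → bit (large x) + countTrue m (large ∘ d ∘ suc)) d₀≡2)

layoff-two-roomy : ∀ {t} {d : Fin (4 + t) → ℕ} → Admissible d → d zero ≡ 2 → sum d + 6 ≤ 4 * (4 + t) →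
                   2 ≤ countTrue (4 + t) (large ∘ d) → AdmissibleGraphical (3 + t) → Graphical d
layoff-two-roomy {t} {d} A d₀≡2 roomy two =
  layoff-step A d₀≥2 (≤-trans (few-full 2 A too-many) d₀≥2)
              (≤-trans (≤-reflexive d₀≡2) (subst (2 ≤_) (large-tail d d₀≡2) two)) roomy′
  where
  open Admissible A
  open ≤-Reasoning
  d₀≥2 : 2 ≤ d zero
  d₀≥2 = ≤-reflexive (sym d₀≡2)
  too-many : ¬ (d zero + ((3 + t) * 2 + (1 + t) * 3) ≤ sum d)
  too-many big = m+1+n≰m (4 * (4 + t)) (begin
    4 * (4 + t) + suc t                      ≡⟨ excess t ⟩
    2 + ((3 + t) * 2 + (1 + t) * 3) + 6      ≡⟨ cong (λ x → x + ((3 + t) * 2 + (1 + t) * 3) + 6) d₀≡2 ⟨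
    d zero + ((3 + t) * 2 + (1 + t) * 3) + 6 ≤⟨ +-monoˡ-≤ 6 big ⟩
    sum d + 6                                ≤⟨ roomy ⟩
    4 * (4 + t)                              ∎)
    where
    excess : ∀ t → 4 * (4 + t) + suc t ≡ 2 + ((3 + t) * 2 + (1 + t) * 3) + 6
    excess = solve-∀
  roomy′ : ∀ {Y} → LayoffSet d Y → Slack (residual d Y)
  roomy′ {Y} L = inj₁ (x+4≤4[1+m]⇒x≤4m (3 + t) (begin
    sum (residual d Y) + 6 + 4          ≡⟨ shuffle (sum (residual d Y)) ⟩
    sum (residual d Y) + 2 * 2 + 6      ≡⟨ cong (λ x → sum (residual d Y) + 2 * x + 6) d₀≡2 ⟨
    sum (residual d Y) + 2 * d zero + 6 ≡⟨ cong (_+ 6) (LayoffSet.sum≡ L) ⟩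
    sum d + 6                           ≤⟨ roomy ⟩
    4 * (4 + t)                         ∎))
    where
    shuffle : ∀ x → x + 6 + 4 ≡ x + 2 * 2 + 6
    shuffle = solve-∀

layoff-two-tight : ∀ {t} {d : Fin (4 + t) → ℕ} → Admissible d → d zero ≡ 2 → (∀ v → d v ≢ 3) →
                   4 ≤ countTrue (4 + t) (large ∘ d) → AdmissibleGraphical (3 + t) → Graphical d
layoff-two-tight {t} {d} A d₀≡2 no3 four =
  layoff-step A d₀≥2 (≤-trans (few-full 2 A too-many) d₀≥2)
              (≤-trans (≤-reflexive d₀≡2) (≤-trans (s≤s (s≤s z≤n)) four-tail)) tight
  where
  open Admissible A
  open ≤-Reasoning
  d₀≥2 : 2 ≤ d zero
  d₀≥2 = ≤-reflexive (sym d₀≡2)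
  four-tail : 4 ≤ countTrue (3 + t) (large ∘ d ∘ suc)
  four-tail = subst (4 ≤_) (large-tail d d₀≡2) four
  large⇒4≤ : ∀ v → T (large (d v)) → 4 ≤ d v
  large⇒4≤ v isLarge = ≤∧≢⇒< (≤ᵇ⇒≤ 3 (d v) isLarge) (no3 v ∘ sym)
  large-weight : (3 + t) * 2 + 2 * countTrue (3 + t) (large ∘ d ∘ suc) ≤ sum (d ∘ suc)
  large-weight = weighted-count≤sum (large ∘ d ∘ suc) (d ∘ suc) 2 2 weight
    where
    weight : ∀ l → 2 + 2 * bit (large (d (suc l))) ≤ d (suc l)
    weight l with large (d (suc l)) in isLarge
    ... | true  = large⇒4≤ (suc l) (subst T (sym isLarge) _)
    ... | false = lower (suc l)
  2≤t : 2 ≤ t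
  2≤t = *-cancelˡ-≤ 2 (+-cancelˡ-≤ (16 + 2 * t) (2 * 2) (2 * t) (begin
    16 + 2 * t + 2 * 2                    ≡⟨ excess t ⟩
    2 + ((3 + t) * 2 + 2 * 4) + 4         ≤⟨ +-monoˡ-≤ 4 (+-monoʳ-≤ 2 many-large) ⟩
    2 + sum (d ∘ suc) + 4                 ≡⟨ cong (λ x → x + sum (d ∘ suc) + 4) d₀≡2 ⟨
    sum d + 4                             ≤⟨ bound ⟩
    4 * (4 + t)                           ≡⟨ room t ⟩
    16 + 2 * t + 2 * t                    ∎))
    where
    excess : ∀ t → 16 + 2 * t + 2 * 2 ≡ 2 + ((3 + t) * 2 + 2 * 4) + 4
    excess = solve-∀
    many-large : (3 + t) * 2 + 2 * 4 ≤ sum (d ∘ suc)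
    many-large = ≤-trans (+-monoʳ-≤ ((3 + t) * 2) (*-monoʳ-≤ 2 four-tail)) large-weight
    room : ∀ t → 4 * (4 + t) ≡ 16 + 2 * t + 2 * t
    room = solve-∀
  too-many : ¬ (d zero + ((3 + t) * 2 + (1 + t) * 3) ≤ sum d)
  too-many big = <⇒≱ 2≤t (+-cancelˡ-≤ (15 + 4 * t) t 1 (begin
    15 + 4 * t + t                           ≡⟨ excess t ⟩
    2 + ((3 + t) * 2 + (1 + t) * 3) + 4      ≡⟨ cong (λ x → x + ((3 + t) * 2 + (1 + t) * 3) + 4) d₀≡2 ⟨
    d zero + ((3 + t) * 2 + (1 + t) * 3) + 4 ≤⟨ +-monoˡ-≤ 4 big ⟩
    sum d + 4                                ≤⟨ bound ⟩
    4 * (4 + t)                              ≡⟨ room t ⟩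
    15 + 4 * t + 1                           ∎))
    where
    excess : ∀ t → 15 + 4 * t + t ≡ 2 + ((3 + t) * 2 + (1 + t) * 3) + 4
    excess = solve-∀
    room : ∀ t → 4 * (4 + t) ≡ 15 + 4 * t + 1
    room = solve-∀
  tight : ∀ {Y} → LayoffSet d Y → Slack (residual d Y)
  tight {Y} L = inj₂ (≤-trans four-tail (countTrue-mono stays-large))
    where
    stays-large : large ∘ d ∘ suc ⊆ large ∘ residual d Y
    stays-large l isLarge with Y l
    ... | true  = ≤⇒≤ᵇ (∸-monoˡ-≤ 1 (large⇒4≤ (suc l) isLarge))
    ... | false = isLarge

few-large-graphical : ∀ {m} {d : Fin (suc m) → ℕ} → Admissible d → countTrue (suc m) (large ∘ d) ≤ 1 → Graphical d
few-large-graphical {m} {d} A few = almost-2-regular-graphical d a others hub-even (lower a) (s≤s⁻¹ (upper a))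
  where
  open Admissible A
  small : ∀ v → ¬ T (large (d v)) → d v ≡ 2
  small v notLarge = ≤-antisym (s≤s⁻¹ (≰⇒> (notLarge ∘ ≤⇒≤ᵇ))) (lower v)
  hub : ∃ λ a → ∀ v → v ≢ a → d v ≡ 2
  hub with any? (λ v → T? (large (d v)))
  ... | yes (a , a-large) = a , λ v v≢a → small v λ v-large →
          contradiction (≤-trans (countTrue-≥2 (large ∘ d) v≢a v-large a-large) few) λ { (s≤s ()) }
  ... | no none = zero , λ v _ → small v (λ v-large → none (v , v-large))
  a : Fin (suc m)
  a = proj₁ hub
  others : ∀ v → v ≢ a → d v ≡ 2
  others = proj₂ hub
  hub-even : 2 ∣ d a
  hub-even = ∣m+n∣m⇒∣n (subst (2 ∣_) sum≡ even) (n∣m*n m)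
    where
    open ≡-Reasoning
    sum≡ : sum d ≡ m * 2 + d a
    sum≡ = begin
      sum d                    ≡⟨ sum-remove d ⟩
      d a + sum (removeAt d a) ≡⟨ cong (d a +_) (sum-cong-≗ (λ l → others _ (punchInᵢ≢i a l))) ⟩
      d a + sum {m} (λ _ → 2)  ≡⟨ cong (d a +_) (sum-const m 2) ⟩
      d a + m * 2              ≡⟨ +-comm (d a) (m * 2) ⟩
      m * 2 + d a              ∎

module InductionStep {t} {d : Fin (4 + t) → ℕ} (A : Admissible d) (ih : AdmissibleGraphical (3 + t)) where
  open Admissible A

  τ : Fin (4 + t) → Permutation′ (4 + t)
  τ i = transpose zero i

  moved : ∀ i → Admissible (d ∘ (τ i ⟨$⟩ʳ_))
  moved i = Admissible-permute (τ i) A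

  large-moved : ∀ i {k} → k ≤ countTrue (4 + t) (large ∘ d) →
                k ≤ countTrue (4 + t) (large ∘ d ∘ (τ i ⟨$⟩ʳ_))
  large-moved i = subst (_ ≤_) (sym (countTrue-permute (τ i) (large ∘ d)))

  at-three : ∀ i → d i ≡ 3 → 4 ≤ countTrue (4 + t) (large ∘ d) → Graphical d
  at-three i dᵢ≡3 four = Graphical-unpermute (τ i) (layoff-three (moved i) dᵢ≡3 (large-moved i four) ih)

  three≤ : (∀ v → d v ≢ 2) → ∀ v → 3 ≤ d v
  three≤ no2 v = ≤∧≢⇒< (lower v) (no2 v ∘ sym)

  without-two : (∀ v → d v ≢ 2) → Graphical d
  without-two no2 with any? (λ i → d i ≟ 3)
  ... | yes (i , dᵢ≡3) =
    at-three i dᵢ≡3 (≤-trans (m≤m+n 4 t) (≤-reflexive (sym (countTrue-all (large ∘ d) (≤⇒≤ᵇ ∘ three≤ no2)))))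
  ... | no no3 = ⊥-elim (m+1+n≰m (4 * (4 + t)) (begin
    4 * (4 + t) + 4           ≡⟨ cong (_+ 4) (trans (*-comm 4 (4 + t)) (sym (sum-const (4 + t) 4))) ⟩
    sum {4 + t} (λ _ → 4) + 4 ≤⟨ +-monoˡ-≤ 4 (sum-mono-≤ (λ v → ≤∧≢⇒< (three≤ no2 v) (λ e → no3 (v , sym e)))) ⟩
    sum d + 4                 ≤⟨ bound ⟩
    4 * (4 + t)               ∎))
    where open ≤-Reasoning

  with-two : ∀ i → d i ≡ 2 → Graphical d
  with-two i dᵢ≡2 with countTrue (4 + t) (large ∘ d) ≤? 1 | slack
  ... | yes few  | _          = few-large-graphical A few
  ... | no  many | inj₁ roomy = Graphical-unpermute (τ i)
    (layoff-two-roomy (moved i) dᵢ≡2 (subst (λ s → s + 6 ≤ 4 * (4 + t)) (sum-permute d (τ i)) roomy)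
                      (large-moved i (≰⇒> many)) ih)
  ... | no  _    | inj₂ four with any? (λ j → d j ≟ 3)
  ...   | yes (j , dⱼ≡3) = at-three j dⱼ≡3 four
  ...   | no  no3        = Graphical-unpermute (τ i)
    (layoff-two-tight (moved i) dᵢ≡2 (λ v d₃ → no3 (τ i ⟨$⟩ʳ v , d₃)) (large-moved i four) ih)

  graphical : Graphical d
  graphical with any? (λ i → d i ≟ 2)
  ... | yes (i , dᵢ≡2) = with-two i dᵢ≡2
  ... | no  no2        = without-two (λ v d₂ → no2 (v , d₂))

admissible⇒graphical : ∀ n → AdmissibleGraphical n
admissible⇒graphical 0 d A = contradiction (Admissible.bound A) λ ()
admissible⇒graphical 1 d A =
  contradiction (Admissible.upper A zero) (≤⇒≯ (≤-trans (n≤1+n 1) (Admissible.lower A zero)))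
admissible⇒graphical 2 d A = contradiction (Admissible.upper A zero) (≤⇒≯ (Admissible.lower A zero))
admissible⇒graphical 3 d A =
  few-large-graphical A (≤-trans (countTrue-mono none-large) (≤-trans (≤-reflexive (countTrue-none 3)) z≤n))
  where
  none-large : large ∘ d ⊆ (λ _ → false)
  none-large v isLarge = <⇒≱ (Admissible.upper A v) (≤ᵇ⇒≤ 3 (d v) isLarge)
admissible⇒graphical (suc (suc (suc (suc t)))) d A = InductionStep.graphical A (admissible⇒graphical (suc (suc (suc t))))

corollary2p2 : (n : ℕ) (d : Fin n → ℕ)
    → NonIncreasing d
    → 2 ∣ sumFin n d
    → sumFin n d ≤ 4 * (n ∸ 1)
    → (n>4 : 4 < n)
    → d (fromℕ< {0} {n} (≤-trans (s≤s z≤n) n>4)) ≤ n ∸ 1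
    → 2 ≤ d (fromℕ< {n ∸ 1} {n} (n∸1<n n>4))
    → 3 ≤ d (fromℕ< {3} {n} (<-trans (n<1+n 3) n>4))
    → Graphical d
corollary2p2 (suc n) d nonIncreasing even sum≤ n>4 d₁≤n dₙ≥2 d₄≥3 = admissible⇒graphical (suc n) d record
  { lower = λ v → ≤-trans dₙ≥2 (nonIncreasing v _ (below-index (n∸1<n n>4) (s≤s⁻¹ (toℕ<n v))))
  ; upper = λ v → s≤s (≤-trans (nonIncreasing zero v z≤n) d₁≤n)
  ; even  = subst (2 ∣_) (sumFin≡sum (suc n) d) even
  ; bound = begin
      sum d + 4            ≡⟨ cong (_+ 4) (sumFin≡sum (suc n) d) ⟨
      sumFin (suc n) d + 4 ≤⟨ +-monoˡ-≤ 4 sum≤ ⟩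
      4 * n + 4            ≡⟨ trans (+-comm (4 * n) 4) (sym (*-suc 4 n)) ⟩
      4 * suc n            ∎
  ; slack = inj₂ (prefix≤countTrue 4 (large ∘ d) (<⇒≤ n>4) λ v v<4 →
              ≤⇒≤ᵇ (≤-trans d₄≥3 (nonIncreasing v _ (below-index (<-trans (n<1+n 3) n>4) (s≤s⁻¹ v<4)))))
  }
  where
  open ≤-Reasoning
  below-index : ∀ {k} (k<n : k < suc n) {v : Fin (suc n)} → toℕ v ≤ k → toℕ v ≤ toℕ (fromℕ< k<n)
  below-index k<n v≤k = ≤-trans v≤k (≤-reflexive (sym (toℕ-fromℕ< k<n)))
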